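{- Let $n\geq0$ and $h$ be integers with $\lceil n/2\rceil\leq h\leq n$. Then $C_{n,h}^{(3)}$ equals the number of partitions of $n-h$ into at most three parts.
   Context: $\Lambda_3=\mathbb{Z}_{\geq0}^3$, $\mathbf e(1)=(1,0,0)$; the height of $\mathbf v$ is the sum of its coordinates and $\Lambda_3^{(h)}$ is the set of elements of height $h$. $X_3=\{(1,-2,0),(-2,1,0),(-1,-1,1),(0,0,-1)\}$; for $\mathbf{v},\mathbf{w}\in\Lambda_3$, $\mathbf{v}\lessdot\mathbf{w}$ iff $\mathbf{v}-\mathbf{w}\in X_3$; $\prec$ is the transitive closure of $\lessdot$ on $\Lambda_3$. $I(\mathbf v)=\{\mathbf v\}\cup\{\mathbf w\in\Lambda_3:\mathbf w\prec\mathbf v\}$, and $C_{n,h}^{(3)}=|I(n\mathbf{e}(1))\cap\Lambda_3^{(h)}|$. -}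

module Defs where

open import Data.Nat using (ℕ; zero; suc; _+_; _≥_)
open import Data.Integer as ℤ using (ℤ; +_; -[1+_]; _-_)
open import Data.Product using (_×_; _,_; Σ)
open import Data.List using (List; []; _∷_; length)
open import Data.Nat.ListAction using (sum)
open import Data.List.Membership.Propositional using (_∈_)
open import Data.List.Relation.Unary.All using (All)
open import Data.List.Relation.Unary.Linked using (Linked)
open import Data.List.Relation.Unary.Unique.Propositional using (Unique)
open import Relation.Binary.PropositionalEquality using (_≡_)
open import Relation.Binary.Construct.Closure.Transitive using (TransClosure)
open import Data.Sum using (_⊎_)
open import Function.Bundles using (_⇔_)

Λ₃ : Set
Λ₃ = ℕ × ℕ × ℕ

ℤ³ : Set
ℤ³ = ℤ × ℤ × ℤ

ne₁ : ℕ → Λ₃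
ne₁ n = n , 0 , 0

height : Λ₃ → ℕ
height (a , b , c) = a + b + c

_-ᵥ_ : Λ₃ → Λ₃ → ℤ³
(a , b , c) -ᵥ (a' , b' , c') = (+ a - + a') , (+ b - + b') , (+ c - + c')

X₃ : List ℤ³
X₃ = (+ 1 , -[1+ 1 ] , + 0)
   ∷ (-[1+ 1 ] , + 1 , + 0)
   ∷ (-[1+ 0 ] , -[1+ 0 ] , + 1)
   ∷ (+ 0 , + 0 , -[1+ 0 ])
   ∷ []

_⋖_ : Λ₃ → Λ₃ → Set
v ⋖ w = (v -ᵥ w) ∈ X₃

_≺_ : Λ₃ → Λ₃ → Set
v ≺ w = TransClosure _⋖_ v w

InI : Λ₃ → Λ₃ → Set
InI v w = (w ≡ v) ⊎ (w ≺ v)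

HasSize : {A : Set} → (A → Set) → ℕ → Set
HasSize {A} P k =
  Σ (List A) λ L → Unique L × (∀ x → (x ∈ L) ⇔ P x) × length L ≡ k

IsPartitionAtMost3 : ℕ → List ℕ → Set
IsPartitionAtMost3 m ps =
  All (λ p → p ≥ 1) ps × Linked _≥_ ps × 3 ≥ length ps × sum ps ≡ m

ISlice : ℕ → ℕ → Λ₃ → Set
ISlice n h w = InI (ne₁ n) w × height w ≡ h

-- Every cover in X₃ keeps the weight a + 2b + 3c or lowers it by 3, and from n·e(1) every
-- point of weight n − 3t is reached, so I(n·e(1)) consists exactly of those points.  Writing
-- the weight as height + (b + 2c + 3t), the slice of height h corresponds, via
-- (a, b, c) ↦ (b, c, t), to the solutions of b + 2c + 3t = n − h; the condition a ≥ 0 is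
-- automatic since b + c ≤ n − h ≤ h.  Such a solution is the partition 1^b 2^c 3^t of n − h
-- into parts at most 3, and conjugation turns it into a partition into at most three parts.
module Submission where

open import Defs
open import Data.Nat using (ℕ; zero; suc; _+_; _*_; _∸_; _≤_; _<_; _≟_; s≤s; z≤n; ⌈_/2⌉; ⌊_/2⌋)
open import Data.Nat.Properties
open import Data.Nat.Tactic.RingSolver using (solve-∀)
import Data.Integer as ℤ
open import Data.Integer using (+_; -[1+_]; _-_; -_)
import Data.Integer.Properties as ℤ
open import Algebra.Properties.AbelianGroup ℤ.+-0-abelianGroup
  using (//-rightDividesˡ; //-rightDividesʳ; ⁻¹-anti-homo‿-)
open import Data.Product using (_×_; _,_; Σ; ∃-syntax; proj₂)
open import Data.Sum using (inj₁; inj₂)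
open import Data.List using (List; []; _∷_; map; filter; upTo; cartesianProduct)
open import Data.List.Properties using (length-map)
open import Data.Nat.ListAction using (sum)
open import Data.List.Membership.Propositional using (_∈_)
open import Data.List.Membership.Propositional.Properties
  using (∈-map⁺; ∈-map⁻; ∈-filter⁺; ∈-filter⁻; ∈-cartesianProduct⁺; ∈-upTo⁺)
open import Data.List.Relation.Unary.Any using (here; there)
open import Data.List.Relation.Unary.All as All using (All; []; _∷_)
import Data.List.Relation.Unary.All.Properties as All
open import Data.List.Relation.Unary.AllPairs using ([]; _∷_)
open import Data.List.Relation.Unary.Linked using ([]; [-]; _∷_)
open import Data.List.Relation.Unary.Unique.Propositional using (Unique)
import Data.List.Relation.Unary.Unique.Propositional.Properties as Unique
open import Relation.Binary.Construct.Closure.Transitive using ([_]; _∷_; _++_)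
open import Relation.Binary.PropositionalEquality
open import Function.Base using (_∘_)
open import Relation.Nullary using (Dec)
open import Function.Bundles using (_⇔_; mk⇔; Equivalence)

+[k+n]-+n≡+k : ∀ k n → + (k + n) - + n ≡ + k
+[k+n]-+n≡+k k n = //-rightDividesʳ (+ n) (+ k)

+m-+[1+k+m]≡-[1+k] : ∀ k m → + m - + (suc k + m) ≡ -[1+ k ]
+m-+[1+k+m]≡-[1+k] k m = begin
  + m - + (suc k + m)         ≡⟨ ℤ.neg-involutive _ ⟨
  - - (+ m - + (suc k + m))   ≡⟨ cong -_ (⁻¹-anti-homo‿- (+ m) (+ (suc k + m))) ⟩
  - (+ (suc k + m) - + m)     ≡⟨ cong -_ (+[k+n]-+n≡+k (suc k) m) ⟩
  -[1+ k ]                    ∎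
  where open ≡-Reasoning

+m-+n≡+k⇒m≡k+n : ∀ m n {k} → + m - + n ≡ + k → m ≡ k + n
+m-+n≡+k⇒m≡k+n m n eq =
  ℤ.+-injective (trans (sym (//-rightDividesˡ (+ n) (+ m))) (cong (ℤ._+ + n) eq))

+m-+n≡-[1+k]⇒n≡1+k+m : ∀ m n {k} → + m - + n ≡ -[1+ k ] → n ≡ suc k + m
+m-+n≡-[1+k]⇒n≡1+k+m m n eq =
  +m-+n≡+k⇒m≡k+n n m (trans (sym (⁻¹-anti-homo‿- (+ m) (+ n))) (cong -_ eq))

triple-cong : ∀ {A B C : Set} {x x′ : A} {y y′ : B} {z z′ : C} →
  x ≡ x′ → y ≡ y′ → z ≡ z′ → (x , y , z) ≡ (x′ , y′ , z′)
triple-cong refl refl refl = refl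

triple-injective : ∀ {A B C : Set} {x x′ : A} {y y′ : B} {z z′ : C} →
  (x , y , z) ≡ (x′ , y′ , z′) → x ≡ x′ × y ≡ y′ × z ≡ z′
triple-injective refl = refl , refl , refl

infix 4 _⋖′_

-- The relation ⋖ with v − w unfolded: one constructor per element of X₃, named after it.
data _⋖′_ : Λ₃ → Λ₃ → Set where
  +a-2b  : ∀ {a b c} → (suc a , b , c) ⋖′ (a , 2 + b , c)
  -2a+b  : ∀ {a b c} → (a , suc b , c) ⋖′ (2 + a , b , c)
  -a-b+c : ∀ {a b c} → (a , b , suc c) ⋖′ (suc a , suc b , c)
  -c     : ∀ {a b c} → (a , b , c) ⋖′ (a , b , suc c)

⋖′⇒⋖ : ∀ {v w} → v ⋖′ w → v ⋖ w
⋖′⇒⋖ (+a-2b {a} {b} {c}) = here (triple-cong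
  (+[k+n]-+n≡+k 1 a) (+m-+[1+k+m]≡-[1+k] 1 b) (+[k+n]-+n≡+k 0 c))
⋖′⇒⋖ (-2a+b {a} {b} {c}) = there (here (triple-cong
  (+m-+[1+k+m]≡-[1+k] 1 a) (+[k+n]-+n≡+k 1 b) (+[k+n]-+n≡+k 0 c)))
⋖′⇒⋖ (-a-b+c {a} {b} {c}) = there (there (here (triple-cong
  (+m-+[1+k+m]≡-[1+k] 0 a) (+m-+[1+k+m]≡-[1+k] 0 b) (+[k+n]-+n≡+k 1 c))))
⋖′⇒⋖ (-c {a} {b} {c}) = there (there (there (here (triple-cong
  (+[k+n]-+n≡+k 0 a) (+[k+n]-+n≡+k 0 b) (+m-+[1+k+m]≡-[1+k] 0 c)))))

⋖⇒⋖′ : ∀ {v w} → v ⋖ w → v ⋖′ w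
⋖⇒⋖′ {a′ , b′ , c′} {a , b , c} (here eq)
  with Δa , Δb , Δc ← triple-injective eq
  with refl ← +m-+n≡+k⇒m≡k+n a′ a Δa
     | refl ← +m-+n≡-[1+k]⇒n≡1+k+m b′ b Δb
     | refl ← +m-+n≡+k⇒m≡k+n c′ c Δc = +a-2b
⋖⇒⋖′ {a′ , b′ , c′} {a , b , c} (there (here eq))
  with Δa , Δb , Δc ← triple-injective eq
  with refl ← +m-+n≡-[1+k]⇒n≡1+k+m a′ a Δa
     | refl ← +m-+n≡+k⇒m≡k+n b′ b Δb
     | refl ← +m-+n≡+k⇒m≡k+n c′ c Δc = -2a+b
⋖⇒⋖′ {a′ , b′ , c′} {a , b , c} (there (there (here eq)))
  with Δa , Δb , Δc ← triple-injective eq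
  with refl ← +m-+n≡-[1+k]⇒n≡1+k+m a′ a Δa
     | refl ← +m-+n≡-[1+k]⇒n≡1+k+m b′ b Δb
     | refl ← +m-+n≡+k⇒m≡k+n c′ c Δc = -a-b+c
⋖⇒⋖′ {a′ , b′ , c′} {a , b , c} (there (there (there (here eq))))
  with Δa , Δb , Δc ← triple-injective eq
  with refl ← +m-+n≡+k⇒m≡k+n a′ a Δa
     | refl ← +m-+n≡+k⇒m≡k+n b′ b Δb
     | refl ← +m-+n≡-[1+k]⇒n≡1+k+m c′ c Δc = -c

-- a + 2b + 3c, arranged so that weight (ne₁ n) reduces to n.
weight : Λ₃ → ℕ
weight (a , b , c) = c * 3 + (b * 2 + a)

infix 4 _≤₃_

_≤₃_ : ℕ → ℕ → Set
m ≤₃ n = ∃[ t ] t * 3 + m ≡ n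

≤₃-trans : ∀ {m n o} → m ≤₃ n → n ≤₃ o → m ≤₃ o
≤₃-trans {m} (s , refl) (t , refl) = t + s , lemma t s m
  where lemma : ∀ t s m → (t + s) * 3 + m ≡ t * 3 + (s * 3 + m)
        lemma = solve-∀

⋖′-weight : ∀ {v w} → v ⋖′ w → weight v ≤₃ weight w
⋖′-weight (+a-2b  {a} {b} {c}) = 1 , lemma a b c
  where lemma : ∀ a b c → 1 * 3 + (c * 3 + (b * 2 + suc a)) ≡ c * 3 + ((2 + b) * 2 + a)
        lemma = solve-∀
⋖′-weight (-2a+b  {a} {b} {c}) = 0 , lemma a b c
  where lemma : ∀ a b c → c * 3 + (suc b * 2 + a) ≡ c * 3 + (b * 2 + (2 + a))
        lemma = solve-∀
⋖′-weight (-a-b+c {a} {b} {c}) = 0 , lemma a b c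
  where lemma : ∀ a b c → suc c * 3 + (b * 2 + a) ≡ c * 3 + (suc b * 2 + suc a)
        lemma = solve-∀
⋖′-weight -c                   = 1 , refl

infix 4 _≼_

_≼_ : Λ₃ → Λ₃ → Set
w ≼ v = InI v w

≼-trans : ∀ {u v w} → u ≼ v → v ≼ w → u ≼ w
≼-trans (inj₁ refl) v≼w         = v≼w
≼-trans (inj₂ u≺v)  (inj₁ refl) = inj₂ u≺v
≼-trans (inj₂ u≺v)  (inj₂ v≺w)  = inj₂ (u≺v ++ v≺w)

⋖′⇒≼ : ∀ {v w} → v ⋖′ w → v ≼ w
⋖′⇒≼ v⋖′w = inj₂ [ ⋖′⇒⋖ v⋖′w ]

⋖-weight : ∀ v w → v ⋖ w → weight v ≤₃ weight w
⋖-weight v w v⋖w = ⋖′-weight (⋖⇒⋖′ {v} {w} v⋖w)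

≺-weight : ∀ {v w} → v ≺ w → weight v ≤₃ weight w
≺-weight {v} {w} [ v⋖w ]                 = ⋖-weight v w v⋖w
≺-weight {v}     (_∷_ {y = u} v⋖u u≺w) = ≤₃-trans (⋖-weight v u v⋖u) (≺-weight u≺w)

≼-weight : ∀ {v w} → v ≼ w → weight v ≤₃ weight w
≼-weight (inj₁ refl) = 0 , refl
≼-weight (inj₂ v≺w)  = ≺-weight v≺w

b≼aa : ∀ a b c → (a , suc b , c) ≼ (2 + a , b , c)
b≼aa a b c = ⋖′⇒≼ -2a+b

c≼aaa : ∀ a b c → (a , b , suc c) ≼ (3 + a , b , c)
c≼aaa a b c = ≼-trans (⋖′⇒≼ -a-b+c) (⋖′⇒≼ -2a+b)

≼aaa : ∀ a b c → (a , b , c) ≼ (3 + a , b , c)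
≼aaa a b c = ≼-trans (⋖′⇒≼ -c) (c≼aaa a b c)

≼-iterate : ∀ d (u : ℕ → ℕ × ℕ) → (∀ k a → (a , u (suc k)) ≼ (d + a , u k)) →
  ∀ k a → (a , u k) ≼ (k * d + a , u 0)
≼-iterate d u move zero    a = inj₁ refl
≼-iterate d u move (suc k) a = ≼-trans (move k a)
  (subst (λ x → (d + a , u k) ≼ (x , u 0)) (lemma k d a) (≼-iterate d u move k (d + a)))
  where lemma : ∀ k d a → k * d + (d + a) ≡ suc k * d + a
        lemma = solve-∀

-- Going up from w: each b is traded for two a's, then each c for three a's.
≼-ne₁-weight : ∀ w → w ≼ ne₁ (weight w)
≼-ne₁-weight (a , b , c) = ≼-trans
  (≼-iterate 2 (λ k → k , c) (λ k a → b≼aa a k c) b a)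
  (≼-iterate 3 (λ k → 0 , k) (λ k a → c≼aaa a 0 k) c (b * 2 + a))

≤₃⇒ne₁≼ne₁ : ∀ {m n} → m ≤₃ n → ne₁ m ≼ ne₁ n
≤₃⇒ne₁≼ne₁ {m} (t , refl) = ≼-iterate 3 (λ _ → 0 , 0) (λ _ a → ≼aaa a 0 0) t m

≼ne₁⇔weight≤₃ : ∀ {w n} → w ≼ ne₁ n ⇔ weight w ≤₃ n
≼ne₁⇔weight≤₃ {w} = mk⇔ ≼-weight (λ w≤₃n → ≼-trans (≼-ne₁-weight w) (≤₃⇒ne₁≼ne₁ w≤₃n))

Unique-map⁺ : ∀ {A B : Set} {P : A → Set} {f : A → B} →
  (∀ {x y} → P x → P y → f x ≡ f y → x ≡ y) →
  ∀ {xs} → All P xs → Unique xs → Unique (map f xs)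
Unique-map⁺ inj []         []           = []
Unique-map⁺ inj (px ∷ pxs) (x∉xs ∷ xs!) =
  All.map⁺ (All.zipWith (λ (py , x≢y) → x≢y ∘ inj px py) (pxs , x∉xs)) ∷ Unique-map⁺ inj pxs xs!

HasSize-map : ∀ {A B : Set} {P : A → Set} {Q : B → Set} (f : A → B) →
  (∀ {x} → P x → Q (f x)) →
  (∀ {x y} → P x → P y → f x ≡ f y → x ≡ y) →
  (∀ {y} → Q y → ∃[ x ] P x × f x ≡ y) →
  ∀ {k} → HasSize P k → HasSize Q k
HasSize-map {P = P} {Q} f P⇒Q inj surj (xs , xs! , ∈⇔P , refl) =
  map f xs , Unique-map⁺ inj allP xs! , (λ y → mk⇔ (to y) (from y)) , length-map f xs
  where
  allP : All P xs
  allP = All.tabulate (Equivalence.to (∈⇔P _))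
  to : ∀ y → y ∈ map f xs → Q y
  to y y∈ with x , x∈ , refl ← ∈-map⁻ f y∈ = P⇒Q (Equivalence.to (∈⇔P x) x∈)
  from : ∀ y → Q y → y ∈ map f xs
  from y qy with x , px , refl ← surj qy = ∈-map⁺ f (Equivalence.from (∈⇔P x) px)

coordinates≤weight : ∀ a b c →
  a ≤ weight (a , b , c) × b ≤ weight (a , b , c) × c ≤ weight (a , b , c)
coordinates≤weight a b c =
  ≤-trans (m≤n+m a (b * 2)) (m≤n+m _ (c * 3)) ,
  ≤-trans (≤-trans (m≤m*n b 2) (m≤m+n _ a)) (m≤n+m _ (c * 3)) ,
  ≤-trans (m≤m*n c 3) (m≤m+n _ _)

cube : ℕ → List Λ₃
cube m = cartesianProduct (upTo m) (cartesianProduct (upTo m) (upTo m))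

∈-cube : ∀ {m a b c} → a < m → b < m → c < m → (a , b , c) ∈ cube m
∈-cube a<m b<m c<m = ∈-cartesianProduct⁺ (∈-upTo⁺ a<m) (∈-cartesianProduct⁺ (∈-upTo⁺ b<m) (∈-upTo⁺ c<m))

Unique-cube : ∀ m → Unique (cube m)
Unique-cube m = Unique.cartesianProduct⁺ (Unique.upTo⁺ m)
  (Unique.cartesianProduct⁺ (Unique.upTo⁺ m) (Unique.upTo⁺ m))

weight-level-finite : ∀ d → ∃[ k ] HasSize (λ x → weight x ≡ d) k
weight-level-finite d =
  _ , filter weight≟d (cube (suc d)) , Unique.filter⁺ weight≟d (Unique-cube (suc d)) ,
  (λ x → mk⇔ (proj₂ ∘ ∈-filter⁻ weight≟d {xs = cube (suc d)}) (∈-level x)) , refl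
  where
  weight≟d : ∀ x → Dec (weight x ≡ d)
  weight≟d x = weight x ≟ d
  ∈-level : ∀ x → weight x ≡ d → x ∈ filter weight≟d (cube (suc d))
  ∈-level (a , b , c) refl with a≤ , b≤ , c≤ ← coordinates≤weight a b c =
    ∈-filter⁺ weight≟d (∈-cube (s≤s a≤) (s≤s b≤) (s≤s c≤)) refl

weight-split : ∀ a b c t → t * 3 + weight (a , b , c) ≡ height (a , b , c) + weight (b , c , t)
weight-split = lemma
  where lemma : ∀ a b c t → t * 3 + (c * 3 + (b * 2 + a)) ≡ a + b + c + (t * 3 + (c * 2 + b))
        lemma = solve-∀

b+c≤weight : ∀ b c t → b + c ≤ weight (b , c , t)
b+c≤weight b c t = begin
  b + c           ≡⟨ +-comm b c ⟩
  c + b           ≤⟨ +-monoˡ-≤ b (m≤m*n c 2) ⟩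
  c * 2 + b       ≤⟨ m≤n+m _ (t * 3) ⟩
  weight (b , c , t) ∎
  where open ≤-Reasoning

withHeight : ℕ → Λ₃ → Λ₃
withHeight h (b , c , t) = h ∸ (b + c) , b , c

withHeight-ISlice : ∀ {n h} → h ≤ n → n ∸ h ≤ h →
  ∀ {x} → weight x ≡ n ∸ h → ISlice n h (withHeight h x)
withHeight-ISlice {n} {h} h≤n n∸h≤h {b , c , t} weight≡n∸h =
  Equivalence.from ≼ne₁⇔weight≤₃ (t , weight≡n) , height≡h
  where
  height≡h : height (withHeight h (b , c , t)) ≡ h
  height≡h = trans (+-assoc (h ∸ (b + c)) b c)
    (m∸n+n≡m (≤-trans (b+c≤weight b c t) (≤-trans (≤-reflexive weight≡n∸h) n∸h≤h)))
  weight≡n : t * 3 + weight (withHeight h (b , c , t)) ≡ n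
  weight≡n = begin
    t * 3 + weight (withHeight h (b , c , t))              ≡⟨ weight-split (h ∸ (b + c)) b c t ⟩
    height (withHeight h (b , c , t)) + weight (b , c , t) ≡⟨ cong₂ _+_ height≡h weight≡n∸h ⟩
    h + (n ∸ h)                                            ≡⟨ m+[n∸m]≡n h≤n ⟩
    n                                                      ∎
    where open ≡-Reasoning

withHeight-injective : ∀ {h x y} → weight x ≡ weight y → withHeight h x ≡ withHeight h y → x ≡ y
withHeight-injective {x = b , c , t} {_ , _ , t′} weight≡ eq
  with _ , refl , refl ← triple-injective eq =
  cong (λ t → b , c , t) (*-cancelʳ-≡ t t′ 3 (+-cancelʳ-≡ _ (t * 3) (t′ * 3) weight≡))

ISlice⇒withHeight : ∀ {n h w} → ISlice n h w → ∃[ x ] weight x ≡ n ∸ h × withHeight h x ≡ w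
ISlice⇒withHeight {w = a , b , c} (w≼ne₁n , refl)
  with t , weight≡n ← Equivalence.to ≼ne₁⇔weight≤₃ w≼ne₁n =
  (b , c , t) ,
  trans (sym (m+n∸m≡n (height (a , b , c)) _))
        (cong (_∸ height (a , b , c)) (trans (sym (weight-split a b c t)) weight≡n)) ,
  cong (_, b , c) (trans (cong (_∸ (b + c)) (+-assoc a b c)) (m+n∸n≡m a (b + c)))

ISlice-size : ∀ {n h} → h ≤ n → n ∸ h ≤ h →
  ∀ {k} → HasSize (λ x → weight x ≡ n ∸ h) k → HasSize (ISlice n h) k
ISlice-size {h = h} h≤n n∸h≤h = HasSize-map (withHeight h)
  (λ {x} → withHeight-ISlice h≤n n∸h≤h {x})
  (λ wx wy → withHeight-injective (trans wx (sym wy)))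
  ISlice⇒withHeight

-- (b, c, t) stands for the partition 1^b 2^c 3^t; its conjugate has the parts
-- b + c + t ≥ c + t ≥ t, of which the zero ones are dropped.
conjugate : Λ₃ → List ℕ
conjugate (b , c , suc t)       = b + (c + suc t) ∷ c + suc t ∷ suc t ∷ []
conjugate (b , suc c , zero)    = b + suc c ∷ suc c ∷ []
conjugate (suc b , zero , zero) = suc b ∷ []
conjugate (zero , zero , zero)  = []

conjugate⁻¹ : List ℕ → Λ₃
conjugate⁻¹ []                  = 0 , 0 , 0
conjugate⁻¹ (x ∷ [])            = x , 0 , 0
conjugate⁻¹ (x ∷ y ∷ [])        = x ∸ y , y , 0
conjugate⁻¹ (x ∷ y ∷ z ∷ [])    = x ∸ y , y ∸ z , z
conjugate⁻¹ (_ ∷ _ ∷ _ ∷ _ ∷ _) = 0 , 0 , 0  -- junk: not a partition into at most three parts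

conjugate⁻¹-conjugate : ∀ x → conjugate⁻¹ (conjugate x) ≡ x
conjugate⁻¹-conjugate (b , c , suc t) =
  triple-cong (m+n∸n≡m b (c + suc t)) (m+n∸n≡m c (suc t)) refl
conjugate⁻¹-conjugate (b , suc c , zero)    = cong (_, suc c , 0) (m+n∸n≡m b (suc c))
conjugate⁻¹-conjugate (suc b , zero , zero) = refl
conjugate⁻¹-conjugate (zero , zero , zero)  = refl

sum-conjugate : ∀ x → sum (conjugate x) ≡ weight x
sum-conjugate (b , c , suc t) = lemma b c t
  where lemma : ∀ b c t → b + (c + suc t) + (c + suc t + (suc t + 0)) ≡ suc t * 3 + (c * 2 + b)
        lemma = solve-∀
sum-conjugate (b , suc c , zero) = lemma b c
  where lemma : ∀ b c → b + suc c + (suc c + 0) ≡ suc c * 2 + b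
        lemma = solve-∀
sum-conjugate (suc b , zero , zero) = +-identityʳ (suc b)
sum-conjugate (zero , zero , zero)  = refl

conjugate-isPartition : ∀ x → IsPartitionAtMost3 (weight x) (conjugate x)
conjugate-isPartition x@(b , c , suc t) =
  (≤-trans middle≥1 (m≤n+m _ b) ∷ middle≥1 ∷ s≤s z≤n ∷ []) ,
  (m≤n+m _ b ∷ m≤n+m _ c ∷ [-]) , ≤-refl , sum-conjugate x
  where middle≥1 : 1 ≤ c + suc t
        middle≥1 = ≤-trans (s≤s z≤n) (m≤n+m (suc t) c)
conjugate-isPartition x@(b , suc c , zero) =
  (≤-trans (s≤s z≤n) (m≤n+m (suc c) b) ∷ s≤s z≤n ∷ []) ,
  (m≤n+m _ b ∷ [-]) , s≤s (s≤s z≤n) , sum-conjugate x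
conjugate-isPartition x@(suc b , zero , zero) = (s≤s z≤n ∷ []) , [-] , s≤s z≤n , sum-conjugate x
conjugate-isPartition (zero , zero , zero)    = [] , [] , z≤n , refl

conjugate-conjugate⁻¹ : ∀ {d ps} → IsPartitionAtMost3 d ps → conjugate (conjugate⁻¹ ps) ≡ ps
conjugate-conjugate⁻¹ {ps = []}                      _ = refl
conjugate-conjugate⁻¹ {ps = suc x ∷ []}              _ = refl
conjugate-conjugate⁻¹ {ps = x ∷ suc y ∷ []}          (_ , x≥y ∷ [-] , _) =
  cong (_∷ suc y ∷ []) (m∸n+n≡m x≥y)
conjugate-conjugate⁻¹ {ps = x ∷ y ∷ suc z ∷ []}      (_ , x≥y ∷ y≥z ∷ [-] , _) =
  cong₂ (λ x y → x ∷ y ∷ suc z ∷ []) (trans (cong (λ u → x ∸ y + u) y∸z+z≡y) (m∸n+n≡m x≥y)) y∸z+z≡y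
  where y∸z+z≡y : y ∸ suc z + suc z ≡ y
        y∸z+z≡y = m∸n+n≡m y≥z
conjugate-conjugate⁻¹ {ps = zero ∷ []}               (() ∷ _ , _)
conjugate-conjugate⁻¹ {ps = _ ∷ zero ∷ []}           (_ ∷ () ∷ _ , _)
conjugate-conjugate⁻¹ {ps = _ ∷ _ ∷ zero ∷ []}       (_ ∷ _ ∷ () ∷ _ , _)
conjugate-conjugate⁻¹ {ps = _ ∷ _ ∷ _ ∷ _ ∷ _}       (_ , _ , s≤s (s≤s (s≤s ())) , _)

partitions-size : ∀ {d k} → HasSize (λ x → weight x ≡ d) k → HasSize (IsPartitionAtMost3 d) k
partitions-size = HasSize-map conjugate
  (λ { refl → conjugate-isPartition _ })
  (λ {x y} _ _ eq → begin
    x                            ≡⟨ conjugate⁻¹-conjugate x ⟨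
    conjugate⁻¹ (conjugate x)    ≡⟨ cong conjugate⁻¹ eq ⟩
    conjugate⁻¹ (conjugate y)    ≡⟨ conjugate⁻¹-conjugate y ⟩
    y                            ∎)
  (λ {ps} part@(_ , _ , _ , sum≡d) → conjugate⁻¹ ps ,
    trans (sym (sum-conjugate (conjugate⁻¹ ps))) (trans (cong sum (conjugate-conjugate⁻¹ part)) sum≡d) ,
    conjugate-conjugate⁻¹ part)
  where open ≡-Reasoning

⌈n/2⌉≤h⇒n∸h≤h : ∀ {n h} → ⌈ n /2⌉ ≤ h → n ∸ h ≤ h
⌈n/2⌉≤h⇒n∸h≤h {n} {h} ⌈n/2⌉≤h = begin
  n ∸ h                    ≡⟨ cong (_∸ h) (⌊n/2⌋+⌈n/2⌉≡n n) ⟨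
  ⌊ n /2⌋ + ⌈ n /2⌉ ∸ h    ≤⟨ ∸-monoˡ-≤ h (+-mono-≤ (≤-trans (⌊n/2⌋≤⌈n/2⌉ n) ⌈n/2⌉≤h) ⌈n/2⌉≤h) ⟩
  h + h ∸ h                ≡⟨ m+n∸n≡m h h ⟩
  h                        ∎
  where open ≤-Reasoning

proposition3p2 : (n h : ℕ) → ⌈ n /2⌉ ≤ h → h ≤ n →
    Σ ℕ (λ k → HasSize (ISlice n h) k × HasSize (IsPartitionAtMost3 (n ∸ h)) k)
proposition3p2 n h ⌈n/2⌉≤h h≤n =
  let k , level = weight-level-finite (n ∸ h) in
  k , ISlice-size h≤n (⌈n/2⌉≤h⇒n∸h≤h ⌈n/2⌉≤h) level , partitions-size level
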